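{- One-root hollow heaps, with operations as defined in the context, correctly implement all the heap operations (every operation returns the item or heap prescribed by its specification), maintain every heap as a heap-ordered tree, and maintain at all times the following rank invariant: a node $u$ of rank $r$ has exactly $r$ ranked children, of ranks $0,1,\ldots,r-1$, unless $r>2$ and $u$ was made hollow by a decrease-key, in which case $u$ has exactly two ranked children, of ranks $r-2$ and $r-1$ (a node may have any number of unranked children).
   Context: Heaps. A heap stores a finite set of items, each with a key from a totally ordered universe, and supports: make-heap() (return an empty heap); find-min($h$) (return an item of minimum key in $h$, or null if $h$ is empty); insert($e,k,h$) (add item $e$, which is in no heap, with key $k$); delete-min($h$) (delete from non-empty $h$ the item that find-min($h$) returns); meld($h_1,h_2$) (return a heap containing all items of the item-disjoint heaps $h_1,h_2$); decrease-key($e,k,h$) (given an item $e$ in $h$ with key greater than $k$, change its key to $k$); delete($e,h$) (delete item $e$ from $h$). Heaps passed as arguments are destroyed; decrease-key and delete are given the location of $e$. Nodes. Nodes hold items: each node holds at most one item, and is full if it holds one and hollow otherwise; each item in a heap is held by exactly one node; a newly created node is full and a hollow node never becomes full again. Each node $u$ has a key $u.key$ (the current key of its item if $u$ is full; if $u$ is hollow, the key its item had just before leaving $u$) and a non-negative integer rank $u.rank$. A tree (or dag) of nodes with arcs from parent to child is heap-ordered if $v.key\le w.key$ for every arc $(v,w)$. For two full roots, link makes the one of larger key (ties broken arbitrarily) a child of the other; the new child is the loser and the other the winner. A ranked link is a link of two roots of equal rank and increases the winner's rank by one; an unranked link may be applied to any two full roots and changes no ranks. One-root hollow heap. It is either empty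 or a single heap-ordered rooted tree of nodes whose root is full; the root is the minimum node. A non-root node is a ranked or unranked child according to whether the link it lost was ranked or unranked; a child keeps this status when moved to a new parent. make-heap returns an empty heap; find-min returns the item in the root; meld returns one heap if the other is empty, and otherwise does an unranked link of the two roots; insert($e,k,h$) creates a new full node of rank 0 holding $e$ with key $k$ and melds this one-node heap with $h$. decrease-key($e,k,h$), with $u$ the node holding $e$: if $u$ is the root one may simply set $u.key=k$; otherwise create a new node $v$, move $e$ from $u$ to $v$ (so $u$ becomes hollow), set $v.key=k$ and $v.rank=\max\{0,u.rank-2\}$, move to $v$ every ranked child of $u$ of rank less than $v.rank$ and any subset of the unranked children of $u$ (with their subtrees), and meld the tree rooted at $v$ with the heap. delete($e,h$) removes $e$ from the node $u$ holding it, making $u$ hollow; if $u$ is not the root this completes the operation; otherwise, while some root is hollow, destroy such a root, making its children roots; then do ranked links while two roots have equal rank; then do unranked links until one root remains. delete-min($h$) performs delete on the item in the root. -}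

module Defs where

open import Level using (Level; _⊔_; 0ℓ)
open import Function using (_∘_)
open import Data.Nat using (ℕ; zero; suc; _∸_; _<_; _≤_)
open import Data.List using (List; []; _∷_; _++_; map; upTo)
open import Data.List.Relation.Unary.All using (All)
open import Data.List.Relation.Unary.Unique.Propositional using (Unique)
open import Data.List.Membership.Propositional using (_∈_; _∉_)
open import Data.List.Relation.Binary.Permutation.Propositional using (_↭_)
open import Data.Maybe using (Maybe; just; nothing)
open import Data.Product using (Σ; _×_; _,_; proj₁; proj₂)
open import Data.Sum using (_⊎_)
open import Data.Unit.Polymorphic using (⊤)
open import Relation.Nullary using (¬_)
open import Relation.Binary.Bundles using (TotalOrder)
open import Relation.Binary.PropositionalEquality using (_≡_)

-- All nondeterministic choices
-- of the algorithm (tie breaking in links, which unranked children move in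
-- decrease-key, which hollow root is destroyed, which pair of roots is
-- linked) are modelled by relations: every allowed execution is an inhabitant.
module HollowHeap {i c ℓ₁ ℓ₂} (Item : Set i) (O : TotalOrder c ℓ₁ ℓ₂) where

  Key : Set c
  Key = TotalOrder.Carrier O

  _≈ₖ_ : Key → Key → Set ℓ₁
  _≈ₖ_ = TotalOrder._≈_ O

  _≤ₖ_ : Key → Key → Set ℓ₂
  _≤ₖ_ = TotalOrder._≤_ O

  _<ₖ_ : Key → Key → Set (ℓ₁ ⊔ ℓ₂)
  a <ₖ b = a ≤ₖ b × ¬ (a ≈ₖ b)

  data Status : Set i where
    full      : Item → Status
    hollowDK  : Status
    hollowDel : Status

  data IsFull : Status → Set i where
    isFull : ∀ {e} → IsFull (full e)

  data IsHollow : Status → Set where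
    isHollowDK  : IsHollow hollowDK
    isHollowDel : IsHollow hollowDel

  -- a child is ranked or unranked according to the link it lost
  data Kind : Set where
    ranked unranked : Kind

  data Tree : Set (i ⊔ c) where
    node : Status → Key → ℕ → List (Kind × Tree) → Tree

  status : Tree → Status
  status (node s _ _ _) = s

  key : Tree → Key
  key (node _ k _ _) = k

  rank : Tree → ℕ
  rank (node _ _ r _) = r

  children : Tree → List (Kind × Tree)
  children (node _ _ _ cs) = cs

  Heap : Set (i ⊔ c)
  Heap = Maybe Tree

  held : Status → Key → List (Item × Key)
  held (full e)  k = (e , k) ∷ []
  held hollowDK  _ = []
  held hollowDel _ = []

  mutual
    contentsT : Tree → List (Item × Key)
    contentsT (node s k _ cs) = held s k ++ contentsF cs

    contentsF : List (Kind × Tree) → List (Item × Key)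
    contentsF [] = []
    contentsF ((_ , t) ∷ cs) = contentsT t ++ contentsF cs

  contents : Heap → List (Item × Key)
  contents nothing  = []
  contents (just t) = contentsT t

  items : Heap → List Item
  items h = map proj₁ (contents h)

  Disjoint : List Item → List Item → Set i
  Disjoint xs ys = ∀ {x} → x ∈ xs → x ∉ ys

  data HeapOrdered : Tree → Set (i ⊔ c ⊔ ℓ₂) where
    node : ∀ {s k r cs} →
      All (λ p → (k ≤ₖ key (proj₂ p)) × HeapOrdered (proj₂ p)) cs →
      HeapOrdered (node s k r cs)

  rankedRanks : List (Kind × Tree) → List ℕ
  rankedRanks [] = []
  rankedRanks ((ranked , t) ∷ cs)   = rank t ∷ rankedRanks cs
  rankedRanks ((unranked , _) ∷ cs) = rankedRanks cs

  RankCond : Status → ℕ → List ℕ → Set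
  RankCond (full _)  r rs = rs ↭ upTo r
  RankCond hollowDel r rs = rs ↭ upTo r
  RankCond hollowDK  r rs =
    (2 < r × rs ↭ (r ∸ 2 ∷ r ∸ 1 ∷ [])) ⊎ (r ≤ 2 × rs ↭ upTo r)

  data RankInv : Tree → Set (i ⊔ c) where
    node : ∀ {s k r cs} →
      RankCond s r (rankedRanks cs) →
      All (λ p → RankInv (proj₂ p)) cs →
      RankInv (node s k r cs)

  HeapInv : Heap → Set (i ⊔ c ⊔ ℓ₂)
  HeapInv nothing  = ⊤
  HeapInv (just t) = IsFull (status t) × HeapOrdered t × RankInv t

  findMin : Heap → Maybe Item
  findMin nothing = nothing
  findMin (just (node (full e) _ _ _)) = just e
  findMin (just (node hollowDK _ _ _)) = nothing
  findMin (just (node hollowDel _ _ _)) = nothing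

  addChild : Kind → Tree → Tree → Tree
  addChild ranked   c (node s k r cs) = node s k (suc r) ((ranked , c) ∷ cs)
  addChild unranked c (node s k r cs) = node s k r ((unranked , c) ∷ cs)

  data Link (kd : Kind) : Tree → Tree → Tree → Set (i ⊔ c ⊔ ℓ₂) where
    winˡ : ∀ {a b} → IsFull (status a) → IsFull (status b) →
      key a ≤ₖ key b → Link kd a b (addChild kd b a)
    winʳ : ∀ {a b} → IsFull (status a) → IsFull (status b) →
      key b ≤ₖ key a → Link kd a b (addChild kd a b)

  RankedLink : Tree → Tree → Tree → Set (i ⊔ c ⊔ ℓ₂)
  RankedLink a b w = rank a ≡ rank b × Link ranked a b w

  data Meld : Heap → Heap → Heap → Set (i ⊔ c ⊔ ℓ₂) where
    emptyˡ : ∀ {h} → Meld nothing h h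
    emptyʳ : ∀ {t} → Meld (just t) nothing (just t)
    link   : ∀ {a b w} → Link unranked a b w → Meld (just a) (just b) (just w)

  Insert : Item → Key → Heap → Heap → Set (i ⊔ c ⊔ ℓ₂)
  Insert e k h h' = Meld (just (node (full e) k 0 [])) h h'

  -- one-hole contexts: locate a node anywhere in a tree
  data Ctx : Set (i ⊔ c) where
    hole  : Ctx
    under : Status → Key → ℕ → List (Kind × Tree) → Kind → Ctx →
            List (Kind × Tree) → Ctx

  plug : Ctx → Tree → Tree
  plug hole u = u
  plug (under s k r ls kd C rs) u = node s k r (ls ++ (kd , plug C u) ∷ rs)

  data DecKey (e : Item) (k : Key) : Heap → Heap → Set (i ⊔ c ⊔ ℓ₁ ⊔ ℓ₂) where
    atRoot : ∀ {k₀ r cs} → k <ₖ k₀ →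
      DecKey e k (just (node (full e) k₀ r cs)) (just (node (full e) k r cs))
    -- u is not the root: new node v of rank max(0, r-2) = r ∸ 2 takes e,
    -- all ranked children of rank < r ∸ 2 and any subset of the unranked
    -- children; u becomes hollow (keeping its old key); v is melded with
    -- the heap
    nonRoot : ∀ {s k' r' ls kd C rs k₀ r cs mr mu kr ku h'} →
      k <ₖ k₀ →
      cs ↭ (mr ++ mu ++ kr ++ ku) →
      All (λ p → (proj₁ p ≡ ranked) × (rank (proj₂ p) < r ∸ 2)) mr →
      All (λ p → proj₁ p ≡ unranked) mu →
      All (λ p → (proj₁ p ≡ ranked) × (r ∸ 2 ≤ rank (proj₂ p))) kr →
      All (λ p → proj₁ p ≡ unranked) ku →
      Meld (just (node (full e) k (r ∸ 2) (mr ++ mu)))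
           (just (plug (under s k' r' ls kd C rs) (node hollowDK k₀ r (kr ++ ku))))
           h' →
      DecKey e k (just (plug (under s k' r' ls kd C rs) (node (full e) k₀ r cs))) h'

  data UnrankedPhase : List Tree → Heap → Set (i ⊔ c ⊔ ℓ₂) where
    none : UnrankedPhase [] nothing
    one  : ∀ {t} → UnrankedPhase (t ∷ []) (just t)
    step : ∀ {ts a b rest w h} → ts ↭ (a ∷ b ∷ rest) → Link unranked a b w →
      UnrankedPhase (w ∷ rest) h → UnrankedPhase ts h

  data RankedPhase : List Tree → Heap → Set (i ⊔ c ⊔ ℓ₂) where
    step   : ∀ {ts a b rest w h} → ts ↭ (a ∷ b ∷ rest) → RankedLink a b w →
      RankedPhase (w ∷ rest) h → RankedPhase ts h
    finish : ∀ {ts h} → Unique (map rank ts) → UnrankedPhase ts h →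
      RankedPhase ts h

  data DestroyPhase : List Tree → Heap → Set (i ⊔ c ⊔ ℓ₂) where
    destroy : ∀ {ts t rest h} → ts ↭ (t ∷ rest) → IsHollow (status t) →
      DestroyPhase (map proj₂ (children t) ++ rest) h → DestroyPhase ts h
    finish  : ∀ {ts h} → All (IsFull ∘ status) ts → RankedPhase ts h →
      DestroyPhase ts h

  data Delete (e : Item) : Heap → Heap → Set (i ⊔ c ⊔ ℓ₂) where
    nonRoot : ∀ {s k' r' ls kd C rs k r cs} →
      Delete e (just (plug (under s k' r' ls kd C rs) (node (full e) k r cs)))
               (just (plug (under s k' r' ls kd C rs) (node hollowDel k r cs)))
    root : ∀ {k r cs h'} →
      DestroyPhase (node hollowDel k r cs ∷ []) h' →
      Delete e (just (node (full e) k r cs)) h'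

  data DeleteMin : Heap → Heap → Set (i ⊔ c ⊔ ℓ₂) where
    deleteRoot : ∀ {e k r cs h'} → Delete e (just (node (full e) k r cs)) h' →
      DeleteMin (just (node (full e) k r cs)) h'

  data Reachable : Heap → Set (i ⊔ c ⊔ ℓ₁ ⊔ ℓ₂) where
    makeHeap  : Reachable nothing
    insert    : ∀ {e k h h'} → Reachable h → e ∉ items h → Insert e k h h' →
      Reachable h'
    meld      : ∀ {h₁ h₂ h'} → Reachable h₁ → Reachable h₂ →
      Disjoint (items h₁) (items h₂) → Meld h₁ h₂ h' → Reachable h'
    decKey    : ∀ {e k h h'} → Reachable h → DecKey e k h h' → Reachable h'
    delete    : ∀ {e h h'} → Reachable h → Delete e h h' → Reachable h'
    deleteMin : ∀ {h h'} → Reachable h → DeleteMin h h' → Reachable h'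

-- Every operation only creates or empties a node and relinks whole subtrees, so the (item, key)
-- pairs held by a heap change exactly as specified, up to permutation; heap order
-- survives because a link hangs the larger key below the smaller one.  For the rank
-- invariant, unranked children are invisible, and a ranked link of two full roots of
-- rank r gives the winner ranked children of ranks 0, …, r.  Decrease-key on a node u
-- of rank r cuts its ranked children (ranks 0, …, r-1) at r-2: ranks below r-2 go to
-- the new node v of rank r-2 and u keeps r-2, r-1, which is the exceptional clause of
-- the invariant when r > 2 and the ordinary one when r ≤ 2.  Every nondeterministic
-- step can be carried out: keys are totally ordered, destroying hollow roots ends at
-- their full descendants, and each ranked link removes a root.
module Submission where

open import Defs
open import Level using (_⊔_)
open import Function using (_∘_)
open import Data.Empty using (⊥-elim)
open import Data.Unit.Polymorphic using (⊤; tt)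
open import Data.Nat using (ℕ; zero; suc; _∸_; _<_; _≤_; z≤n; s≤s; s≤s⁻¹; _<?_; _≤?_; _≟_)
open import Data.Nat.Properties using (≤-refl; n≤1+n; ≤⇒≯; <⇒≱; ≮⇒≥)
open import Data.List using (List; []; _∷_; _++_; [_]; map; upTo; concatMap; filter; length)
open import Data.List.Properties
  using (++-assoc; ++-identityʳ; map-++; concatMap-++; upTo-∷ʳ; filter-++; filter-all; filter-none)
open import Data.List.Relation.Unary.All as All using (All; []; _∷_)
import Data.List.Relation.Unary.All.Properties as All
open import Data.List.Relation.Unary.Any using (here; any?)
open import Data.List.Relation.Unary.AllPairs using ([]; _∷_)
open import Data.List.Relation.Unary.Unique.Propositional using (Unique)
import Data.List.Relation.Unary.Unique.Propositional.Properties as Unique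
open import Data.List.Membership.Propositional using (_∈_; _∉_; find)
open import Data.List.Membership.Propositional.Properties using (∈-++⁻; ∈-map⁻; ∈-∃++)
open import Data.List.Relation.Binary.Permutation.Propositional
  using (_↭_; refl; prep; swap; trans; ↭-sym; ↭-reflexive; ↭⇒↭ₛ; module PermutationReasoning)
open import Data.List.Relation.Binary.Permutation.Propositional.Properties
  using ( All-resp-↭; ++⁺ˡ; ++⁺ʳ; ++-comm; shift; shifts; ∷↭∷ʳ
        ; ↭-empty-inv; ↭-singleton-inv; ↭-length; filter-↭)
  renaming (map⁺ to ↭-map⁺)
import Data.List.Relation.Binary.Permutation.Setoid.Properties as ↭ₛ
open import Data.Maybe using (just; nothing)
open import Data.Product using (Σ; _×_; _,_; proj₁; proj₂; map₂)
open import Data.Sum using (_⊎_; inj₁; inj₂)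
open import Relation.Nullary using (yes; no)
open import Relation.Unary using (Pred; Decidable; ∁)
open import Relation.Binary.Bundles using (TotalOrder)
open import Relation.Binary.PropositionalEquality
  using (_≡_; _≢_; refl; sym; cong; cong₂; subst; setoid; module ≡-Reasoning)
  renaming (trans to ≡-trans)

module _ {a} {A : Set a} where

  Unique-resp-↭ : {xs ys : List A} → xs ↭ ys → Unique xs → Unique ys
  Unique-resp-↭ p = ↭ₛ.Unique-resp-↭ (setoid A) (↭⇒↭ₛ p)

  All-middle : ∀ {p} {P : Pred A p} ls {x} rs → All P (ls ++ x ∷ rs) → P x
  All-middle ls rs = All.head ∘ All.++⁻ʳ ls

  All-updateMiddle : ∀ {p} {P : Pred A p} ls {x y} rs →
    (P x → P y) → All P (ls ++ x ∷ rs) → All P (ls ++ y ∷ rs)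
  All-updateMiddle []       rs f (px ∷ ps) = f px ∷ ps
  All-updateMiddle (l ∷ ls) rs f (pl ∷ ps) = pl ∷ All-updateMiddle ls rs f ps

  module _ {p} {P : Pred A p} (P? : Decidable P) where

    filter-partitioned : ∀ {xs ys} → All P xs → All (∁ P) ys → filter P? (xs ++ ys) ≡ xs
    filter-partitioned {xs} {ys} pxs ¬pys = begin
      filter P? (xs ++ ys)         ≡⟨ filter-++ P? xs ys ⟩
      filter P? xs ++ filter P? ys ≡⟨ cong₂ _++_ (filter-all P? pxs) (filter-none P? ¬pys) ⟩
      xs ++ []                     ≡⟨ ++-identityʳ xs ⟩
      xs                           ∎
      where open ≡-Reasoning

    separated-↭-prefix : ∀ {xs ys us vs} → All P xs → All (∁ P) ys → All P us → All (∁ P) vs →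
      xs ++ ys ↭ us ++ vs → xs ↭ us
    separated-↭-prefix {xs} {ys} {us} {vs} pxs ¬pys pus ¬pvs p = begin
      xs                   ≡⟨ sym (filter-partitioned pxs ¬pys) ⟩
      filter P? (xs ++ ys) ↭⟨ filter-↭ P? p ⟩
      filter P? (us ++ vs) ≡⟨ filter-partitioned pus ¬pvs ⟩
      us                   ∎
      where open PermutationReasoning

module _ {a b} {A : Set a} {B : Set b} (f : A → List B) where

  concatMap-↭ : ∀ {xs ys} → xs ↭ ys → concatMap f xs ↭ concatMap f ys
  concatMap-↭ refl         = refl
  concatMap-↭ (prep x p)   = ++⁺ˡ (f x) (concatMap-↭ p)
  concatMap-↭ (swap x y p) = trans (shifts (f x) (f y)) (++⁺ˡ (f y) (++⁺ˡ (f x) (concatMap-↭ p)))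
  concatMap-↭ (trans p q)  = trans (concatMap-↭ p) (concatMap-↭ q)

lastTwo : ℕ → List ℕ
lastTwo zero          = []
lastTwo (suc zero)    = [ zero ]
lastTwo (suc (suc n)) = n ∷ suc n ∷ []

upTo-lastTwo : ∀ r → upTo r ≡ upTo (r ∸ 2) ++ lastTwo r
upTo-lastTwo zero          = refl
upTo-lastTwo (suc zero)    = refl
upTo-lastTwo (suc (suc n)) = begin
  upTo (suc (suc n))             ≡⟨ sym (upTo-∷ʳ (suc n)) ⟩
  upTo (suc n) ++ [ suc n ]      ≡⟨ cong (_++ [ suc n ]) (sym (upTo-∷ʳ n)) ⟩
  (upTo n ++ [ n ]) ++ [ suc n ] ≡⟨ ++-assoc (upTo n) [ n ] [ suc n ] ⟩
  upTo n ++ lastTwo (suc (suc n)) ∎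
  where open ≡-Reasoning

lastTwo-≥ : ∀ r → All (r ∸ 2 ≤_) (lastTwo r)
lastTwo-≥ zero          = []
lastTwo-≥ (suc zero)    = z≤n ∷ []
lastTwo-≥ (suc (suc n)) = ≤-refl ∷ n≤1+n n ∷ []

upTo-suc-↭ : ∀ r → r ∷ upTo r ↭ upTo (suc r)
upTo-suc-↭ r = trans (∷↭∷ʳ r (upTo r)) (↭-reflexive (upTo-∷ʳ r))

upTo-split : ∀ r {xs ys} → All (_< r ∸ 2) xs → All (r ∸ 2 ≤_) ys → xs ++ ys ↭ upTo r →
  xs ↭ upTo (r ∸ 2) × ys ↭ lastTwo r
upTo-split r {xs} {ys} xs<m m≤ys p =
  separated-↭-prefix (_<? m) xs<m (All.map ≤⇒≯ m≤ys) (All.all-upTo m) (All.map ≤⇒≯ (lastTwo-≥ r))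
    p′ ,
  separated-↭-prefix (m ≤?_) m≤ys (All.map <⇒≱ xs<m) (lastTwo-≥ r) (All.map <⇒≱ (All.all-upTo m))
    (trans (++-comm ys xs) (trans p′ (++-comm (upTo m) (lastTwo r))))
  where
  m : ℕ
  m = r ∸ 2
  p′ : xs ++ ys ↭ upTo m ++ lastTwo r
  p′ = trans p (↭-reflexive (upTo-lastTwo r))

module HollowHeapProperties {i c ℓ₁ ℓ₂} (Item : Set i) (O : TotalOrder c ℓ₁ ℓ₂) where

  open HollowHeap Item O
  open TotalOrder O using (total) renaming (refl to ≤ₖ-refl; trans to ≤ₖ-trans)

  rootsContents : List Tree → List (Item × Key)
  rootsContents = concatMap contentsT

  contentsF≡rootsContents : ∀ cs → contentsF cs ≡ rootsContents (map proj₂ cs)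
  contentsF≡rootsContents []             = refl
  contentsF≡rootsContents ((_ , t) ∷ cs) = cong (contentsT t ++_) (contentsF≡rootsContents cs)

  contentsF-↭ : ∀ {cs ds} → cs ↭ ds → contentsF cs ↭ contentsF ds
  contentsF-↭ {cs} {ds} p = begin
    contentsF cs                  ≡⟨ contentsF≡rootsContents cs ⟩
    rootsContents (map proj₂ cs)  ↭⟨ concatMap-↭ contentsT (↭-map⁺ proj₂ p) ⟩
    rootsContents (map proj₂ ds)  ≡⟨ sym (contentsF≡rootsContents ds) ⟩
    contentsF ds                  ∎
    where open PermutationReasoning

  contentsF-++ : ∀ cs ds → contentsF (cs ++ ds) ≡ contentsF cs ++ contentsF ds
  contentsF-++ cs ds = begin
    contentsF (cs ++ ds)                                      ≡⟨ contentsF≡rootsContents (cs ++ ds) ⟩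
    rootsContents (map proj₂ (cs ++ ds))                      ≡⟨ cong rootsContents (map-++ proj₂ cs ds) ⟩
    rootsContents (map proj₂ cs ++ map proj₂ ds)
      ≡⟨ concatMap-++ contentsT (map proj₂ cs) (map proj₂ ds) ⟩
    rootsContents (map proj₂ cs) ++ rootsContents (map proj₂ ds)
      ≡⟨ sym (cong₂ _++_ (contentsF≡rootsContents cs) (contentsF≡rootsContents ds)) ⟩
    contentsF cs ++ contentsF ds                              ∎
    where open ≡-Reasoning

  contextContents : Ctx → List (Item × Key)
  contextContents hole                     = []
  contextContents (under s k r ls kd C rs) =
    held s k ++ contentsF ls ++ contextContents C ++ contentsF rs

  plug-contents : ∀ C u → contentsT (plug C u) ↭ contentsT u ++ contextContents C
  plug-contents hole                     u = ↭-sym (↭-reflexive (++-identityʳ (contentsT u)))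
  plug-contents (under s k r ls kd C rs) u = begin
    H ++ contentsF (ls ++ (kd , plug C u) ∷ rs)  ≡⟨ cong (H ++_) (contentsF-++ ls ((kd , plug C u) ∷ rs)) ⟩
    H ++ L ++ contentsT (plug C u) ++ R          ↭⟨ ++⁺ˡ H (++⁺ˡ L (++⁺ʳ R (plug-contents C u))) ⟩
    H ++ L ++ (U ++ X) ++ R                      ≡⟨ cong (λ z → H ++ L ++ z) (++-assoc U X R) ⟩
    H ++ L ++ U ++ X ++ R                        ≡⟨ sym (++-assoc H L (U ++ X ++ R)) ⟩
    (H ++ L) ++ U ++ X ++ R                      ↭⟨ shifts (H ++ L) U ⟩
    U ++ (H ++ L) ++ X ++ R                      ≡⟨ cong (U ++_) (++-assoc H L (X ++ R)) ⟩
    U ++ H ++ L ++ X ++ R                        ∎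
    where
    open PermutationReasoning
    H L R U X : List (Item × Key)
    H = held s k
    L = contentsF ls
    R = contentsF rs
    U = contentsT u
    X = contextContents C

  addChild-contents : ∀ kd x w → contentsT (addChild kd x w) ↭ contentsT x ++ contentsT w
  addChild-contents ranked   x (node s k r cs) = shifts (held s k) (contentsT x)
  addChild-contents unranked x (node s k r cs) = shifts (held s k) (contentsT x)

  link-contents : ∀ {kd a b w} → Link kd a b w → contentsT w ↭ contentsT a ++ contentsT b
  link-contents {kd} {a} {b} (winˡ _ _ _) =
    trans (addChild-contents kd b a) (++-comm (contentsT b) (contentsT a))
  link-contents {kd} {a} {b} (winʳ _ _ _) = addChild-contents kd a b

  meld-contents : ∀ {h₁ h₂ h} → Meld h₁ h₂ h → contents h ↭ contents h₁ ++ contents h₂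
  meld-contents emptyˡ       = refl
  meld-contents (emptyʳ {t}) = ↭-sym (↭-reflexive (++-identityʳ (contentsT t)))
  meld-contents (link l)     = link-contents l

  linkStep-contents : ∀ {kd ts a b rest w} → ts ↭ a ∷ b ∷ rest → Link kd a b w →
    rootsContents (w ∷ rest) ↭ rootsContents ts
  linkStep-contents {ts = ts} {a} {b} {rest} {w} p l = begin
    contentsT w ++ rootsContents rest                    ↭⟨ ++⁺ʳ (rootsContents rest) (link-contents l) ⟩
    (contentsT a ++ contentsT b) ++ rootsContents rest
      ≡⟨ ++-assoc (contentsT a) (contentsT b) (rootsContents rest) ⟩
    rootsContents (a ∷ b ∷ rest)                         ↭⟨ concatMap-↭ contentsT (↭-sym p) ⟩
    rootsContents ts                                     ∎
    where open PermutationReasoning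

  unrankedPhase-contents : ∀ {ts h} → UnrankedPhase ts h → contents h ↭ rootsContents ts
  unrankedPhase-contents none         = refl
  unrankedPhase-contents (one {t})    = ↭-sym (↭-reflexive (++-identityʳ (contentsT t)))
  unrankedPhase-contents (step p l d) = trans (unrankedPhase-contents d) (linkStep-contents p l)

  rankedPhase-contents : ∀ {ts h} → RankedPhase ts h → contents h ↭ rootsContents ts
  rankedPhase-contents (step p (_ , l) d) = trans (rankedPhase-contents d) (linkStep-contents p l)
  rankedPhase-contents (finish _ d)       = unrankedPhase-contents d

  hollow-contents : ∀ t → IsHollow (status t) → contentsT t ≡ contentsF (children t)
  hollow-contents (node hollowDK  k r cs) isHollowDK  = refl
  hollow-contents (node hollowDel k r cs) isHollowDel = refl

  destroyPhase-contents : ∀ {ts h} → DestroyPhase ts h → contents h ↭ rootsContents ts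
  destroyPhase-contents (finish _ d) = rankedPhase-contents d
  destroyPhase-contents (destroy {ts} {t} {rest} {h} p hol d) = begin
    contents h                                            ↭⟨ destroyPhase-contents d ⟩
    rootsContents (map proj₂ (children t) ++ rest)
      ≡⟨ concatMap-++ contentsT (map proj₂ (children t)) rest ⟩
    rootsContents (map proj₂ (children t)) ++ rootsContents rest
      ≡⟨ cong (_++ rootsContents rest) (sym (≡-trans (hollow-contents t hol)
                                                     (contentsF≡rootsContents (children t)))) ⟩
    rootsContents (t ∷ rest)                              ↭⟨ concatMap-↭ contentsT (↭-sym p) ⟩
    rootsContents ts                                      ∎
    where open PermutationReasoning

  delete-contents : ∀ {e h h'} → Delete e h h' → Σ Key (λ k → contents h ↭ (e , k) ∷ contents h')
  delete-contents {e} (nonRoot {s} {k'} {r'} {ls} {kd} {C} {rs} {k} {r} {cs}) =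
    k , trans (plug-contents C′ (node (full e) k r cs))
              (prep (e , k) (↭-sym (plug-contents C′ (node hollowDel k r cs))))
    where
    C′ : Ctx
    C′ = under s k' r' ls kd C rs
  delete-contents {e} (root {k} {r} {cs} d) =
    k , prep (e , k) (↭-sym (trans (destroyPhase-contents d) (↭-reflexive (++-identityʳ (contentsF cs)))))

  decKey-contents : ∀ {e k h h'} → DecKey e k h h' →
    Σ Key (λ k₀ → k <ₖ k₀ × Σ (List (Item × Key)) (λ rest →
      contents h ↭ (e , k₀) ∷ rest × contents h' ↭ (e , k) ∷ rest))
  decKey-contents (atRoot {k₀} {r} {cs} k<k₀) = k₀ , k<k₀ , contentsF cs , refl , refl
  decKey-contents {e} {k}
    (nonRoot {s} {k'} {r'} {ls} {kd} {C} {rs} {k₀} {r} {cs} {mr} {mu} {kr} {ku} {h' = h'} k<k₀ p _ _ _ _ m) =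
    k₀ , k<k₀ , contentsF cs ++ X , plug-contents C′ (node (full e) k₀ r cs) , (begin
      contents h'                                                ↭⟨ meld-contents m ⟩
      (e , k) ∷ contentsF (mr ++ mu) ++ contentsT (plug C′ v)
        <⟨ ++⁺ˡ (contentsF (mr ++ mu)) (plug-contents C′ v) ⟩
      (e , k) ∷ contentsF (mr ++ mu) ++ contentsF (kr ++ ku) ++ X
        <⟨ ↭-reflexive (sym (++-assoc (contentsF (mr ++ mu)) (contentsF (kr ++ ku)) X)) ⟩
      (e , k) ∷ (contentsF (mr ++ mu) ++ contentsF (kr ++ ku)) ++ X  <⟨ ++⁺ʳ X moved ⟩
      (e , k) ∷ contentsF cs ++ X                                ∎)
    where
    open PermutationReasoning
    C′ : Ctx
    C′ = under s k' r' ls kd C rs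
    X : List (Item × Key)
    X = contextContents C′
    v : Tree
    v = node hollowDK k₀ r (kr ++ ku)
    moved : contentsF (mr ++ mu) ++ contentsF (kr ++ ku) ↭ contentsF cs
    moved = begin
      contentsF (mr ++ mu) ++ contentsF (kr ++ ku) ≡⟨ sym (contentsF-++ (mr ++ mu) (kr ++ ku)) ⟩
      contentsF ((mr ++ mu) ++ kr ++ ku)           ≡⟨ cong contentsF (++-assoc mr mu (kr ++ ku)) ⟩
      contentsF (mr ++ mu ++ kr ++ ku)             ↭⟨ contentsF-↭ (↭-sym p) ⟩
      contentsF cs                                 ∎

  Valid : Tree → Set (i ⊔ c ⊔ ℓ₂)
  Valid t = HeapOrdered t × RankInv t

  OrderedUnder : Key → Kind × Tree → Set (i ⊔ c ⊔ ℓ₂)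
  OrderedUnder k p = k ≤ₖ key (proj₂ p) × HeapOrdered (proj₂ p)

  plug-key : ∀ C {u u'} → key u' ≡ key u → key (plug C u') ≡ key (plug C u)
  plug-key hole                    eq = eq
  plug-key (under _ _ _ _ _ _ _)   _  = refl

  plug-rank : ∀ C {u u'} → rank u' ≡ rank u → rank (plug C u') ≡ rank (plug C u)
  plug-rank hole                  eq = eq
  plug-rank (under _ _ _ _ _ _ _) _  = refl

  rankedRanks-middle : ∀ ls {kd a b} rs → rank a ≡ rank b →
    rankedRanks (ls ++ (kd , a) ∷ rs) ≡ rankedRanks (ls ++ (kd , b) ∷ rs)
  rankedRanks-middle []                   {ranked}   rs eq = cong (_∷ rankedRanks rs) eq
  rankedRanks-middle []                   {unranked} rs eq = refl
  rankedRanks-middle ((ranked , t) ∷ ls)   rs eq = cong (rank t ∷_) (rankedRanks-middle ls rs eq)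
  rankedRanks-middle ((unranked , t) ∷ ls) rs eq = rankedRanks-middle ls rs eq

  plug-heapOrdered⁻ : ∀ C u → HeapOrdered (plug C u) → HeapOrdered u
  plug-heapOrdered⁻ hole                     u ho        = ho
  plug-heapOrdered⁻ (under s k r ls kd C rs) u (node ho) = plug-heapOrdered⁻ C u (proj₂ (All-middle ls rs ho))

  plug-heapOrdered : ∀ C {u u'} → key u' ≡ key u →
    HeapOrdered (plug C u) → HeapOrdered u' → HeapOrdered (plug C u')
  plug-heapOrdered hole                     _    _         ho' = ho'
  plug-heapOrdered (under s k r ls kd C rs) key≡ (node ho) ho' =
    node (All-updateMiddle ls rs
      (λ (k≤ , hoC) → subst (k ≤ₖ_) (sym (plug-key C key≡)) k≤ , plug-heapOrdered C key≡ hoC ho') ho)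

  plug-rankInv⁻ : ∀ C u → RankInv (plug C u) → RankInv u
  plug-rankInv⁻ hole                     u ri          = ri
  plug-rankInv⁻ (under s k r ls kd C rs) u (node _ ri) = plug-rankInv⁻ C u (All-middle ls rs ri)

  plug-rankInv : ∀ C {u u'} → rank u' ≡ rank u →
    RankInv (plug C u) → RankInv u' → RankInv (plug C u')
  plug-rankInv hole                     _     _            ri' = ri'
  plug-rankInv (under s k r ls kd C rs) rank≡ (node rc ri) ri' =
    node (subst (RankCond s r) (rankedRanks-middle ls rs (sym (plug-rank C rank≡))) rc)
         (All-updateMiddle ls rs (λ riC → plug-rankInv C rank≡ riC ri') ri)

  RankCompatible : Kind → Tree → Tree → Set
  RankCompatible ranked   a b = rank a ≡ rank b
  RankCompatible unranked a b = ⊤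

  RankCompatible-sym : ∀ kd {a b} → RankCompatible kd a b → RankCompatible kd b a
  RankCompatible-sym ranked   eq = sym eq
  RankCompatible-sym unranked _  = tt

  addChild-full : ∀ kd x w → IsFull (status w) → IsFull (status (addChild kd x w))
  addChild-full ranked   x (node s k r cs) isFull = isFull
  addChild-full unranked x (node s k r cs) isFull = isFull

  addChild-heapOrdered : ∀ kd x w → key w ≤ₖ key x →
    HeapOrdered w → HeapOrdered x → HeapOrdered (addChild kd x w)
  addChild-heapOrdered ranked   x (node s k r cs) w≤x (node ho) hoₓ = node ((w≤x , hoₓ) ∷ ho)
  addChild-heapOrdered unranked x (node s k r cs) w≤x (node ho) hoₓ = node ((w≤x , hoₓ) ∷ ho)

  addChild-rankInv : ∀ kd x w → RankCompatible kd x w → IsFull (status w) →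
    RankInv w → RankInv x → RankInv (addChild kd x w)
  addChild-rankInv ranked x (node (full e) k r cs) refl isFull (node rc ri) riₓ =
    node (trans (prep r rc) (upTo-suc-↭ r)) (riₓ ∷ ri)
  addChild-rankInv unranked x (node s k r cs) _ _ (node rc ri) riₓ = node rc (riₓ ∷ ri)

  link-full : ∀ {kd a b w} → Link kd a b w → IsFull (status w)
  link-full {kd} {a} {b} (winˡ fa _ _) = addChild-full kd b a fa
  link-full {kd} {a} {b} (winʳ _ fb _) = addChild-full kd a b fb

  link-heapInv : ∀ {kd a b w} → Link kd a b w → RankCompatible kd a b →
    HeapInv (just a) → HeapInv (just b) → HeapInv (just w)
  link-heapInv {kd} {a} {b} (winˡ _ _ a≤b) compat (fa , hoa , ria) (_ , hob , rib) =
    addChild-full kd b a fa ,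
    addChild-heapOrdered kd b a a≤b hoa hob ,
    addChild-rankInv kd b a (RankCompatible-sym kd compat) fa ria rib
  link-heapInv {kd} {a} {b} (winʳ _ _ b≤a) compat (_ , hoa , ria) (fb , hob , rib) =
    addChild-full kd a b fb ,
    addChild-heapOrdered kd a b b≤a hob hoa ,
    addChild-rankInv kd a b compat fb rib ria

  meld-heapInv : ∀ {h₁ h₂ h} → Meld h₁ h₂ h → HeapInv h₁ → HeapInv h₂ → HeapInv h
  meld-heapInv emptyˡ   _   inv₂ = inv₂
  meld-heapInv emptyʳ   inv₁ _   = inv₁
  meld-heapInv (link l) inv₁ inv₂ = link-heapInv l tt inv₁ inv₂

  unrankedPhase-heapInv : ∀ {ts h} → UnrankedPhase ts h → All (HeapInv ∘ just) ts → HeapInv h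
  unrankedPhase-heapInv none         _          = tt
  unrankedPhase-heapInv one          (inv ∷ []) = inv
  unrankedPhase-heapInv (step p l d) invs with All-resp-↭ p invs
  ... | inva ∷ invb ∷ invs′ = unrankedPhase-heapInv d (link-heapInv l tt inva invb ∷ invs′)

  rankedPhase-heapInv : ∀ {ts h} → RankedPhase ts h → All (HeapInv ∘ just) ts → HeapInv h
  rankedPhase-heapInv (finish _ d)           invs = unrankedPhase-heapInv d invs
  rankedPhase-heapInv (step p (eq , l) d) invs with All-resp-↭ p invs
  ... | inva ∷ invb ∷ invs′ = rankedPhase-heapInv d (link-heapInv l eq inva invb ∷ invs′)

  children-valid : ∀ t → Valid t → All Valid (map proj₂ (children t))
  children-valid (node s k r cs) (node ho , node _ ri) = All.map⁺ (All.zip (All.map proj₂ ho , ri))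

  destroyPhase-heapInv : ∀ {ts h} → DestroyPhase ts h → All Valid ts → HeapInv h
  destroyPhase-heapInv (finish fulls d)        valids = rankedPhase-heapInv d (All.zip (fulls , valids))
  destroyPhase-heapInv (destroy {t = t} p _ d) valids with All-resp-↭ p valids
  ... | validₜ ∷ valids′ = destroyPhase-heapInv d (All.++⁺ (children-valid t validₜ) valids′)

  rankedRanks-↭ : ∀ {cs ds} → cs ↭ ds → rankedRanks cs ↭ rankedRanks ds
  rankedRanks-↭ refl = refl
  rankedRanks-↭ (prep (ranked   , t) p) = prep (rank t) (rankedRanks-↭ p)
  rankedRanks-↭ (prep (unranked , t) p) = rankedRanks-↭ p
  rankedRanks-↭ (swap (ranked   , t) (ranked   , u) p) = swap (rank t) (rank u) (rankedRanks-↭ p)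
  rankedRanks-↭ (swap (ranked   , t) (unranked , u) p) = prep (rank t) (rankedRanks-↭ p)
  rankedRanks-↭ (swap (unranked , t) (ranked   , u) p) = prep (rank u) (rankedRanks-↭ p)
  rankedRanks-↭ (swap (unranked , t) (unranked , u) p) = rankedRanks-↭ p
  rankedRanks-↭ (trans p q) = trans (rankedRanks-↭ p) (rankedRanks-↭ q)

  rankedRanks-++ : ∀ cs ds → rankedRanks (cs ++ ds) ≡ rankedRanks cs ++ rankedRanks ds
  rankedRanks-++ []                   ds = refl
  rankedRanks-++ ((ranked , t) ∷ cs)   ds = cong (rank t ∷_) (rankedRanks-++ cs ds)
  rankedRanks-++ ((unranked , t) ∷ cs) ds = rankedRanks-++ cs ds

  IsRanked IsUnranked : Kind × Tree → Set
  IsRanked   (kd , _) = kd ≡ ranked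
  IsUnranked (kd , _) = kd ≡ unranked

  rankedRanks-separated : ∀ {cs ds} → All IsRanked cs → All IsUnranked ds →
    rankedRanks (cs ++ ds) ≡ map (rank ∘ proj₂) cs
  rankedRanks-separated {ds = []}            []         []          = refl
  rankedRanks-separated {ds = (_ , _) ∷ ds}  []         (refl ∷ us) = rankedRanks-separated {ds = ds} [] us
  rankedRanks-separated {(_ , t) ∷ cs}       (refl ∷ rs) us          =
    cong (rank t ∷_) (rankedRanks-separated rs us)

  lastTwo-rankCond : ∀ r {rs} → rs ↭ lastTwo r → RankCond hollowDK r rs
  lastTwo-rankCond zero                q = inj₂ (z≤n , q)
  lastTwo-rankCond (suc zero)          q = inj₂ (s≤s z≤n , q)
  lastTwo-rankCond (suc (suc zero))    q = inj₂ (s≤s (s≤s z≤n) , q)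
  lastTwo-rankCond (suc (suc (suc n))) q = inj₁ (s≤s (s≤s (s≤s z≤n)) , q)

  decKey-rankConds : ∀ r {cs mr mu kr ku} → rankedRanks cs ↭ upTo r → cs ↭ mr ++ mu ++ kr ++ ku →
    All (λ p → IsRanked p × rank (proj₂ p) < r ∸ 2) mr → All IsUnranked mu →
    All (λ p → IsRanked p × r ∸ 2 ≤ rank (proj₂ p)) kr → All IsUnranked ku →
    rankedRanks (mr ++ mu) ↭ upTo (r ∸ 2) × RankCond hollowDK r (rankedRanks (kr ++ ku))
  decKey-rankConds r {cs} {mr} {mu} {kr} {ku} rc p mr< mu-unranked kr≥ ku-unranked
    = subst (_↭ upTo (r ∸ 2)) (sym movedRanks) (proj₁ parts) ,
      lastTwo-rankCond r (subst (_↭ lastTwo r) (sym keptRanks) (proj₂ parts))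
    where
    movedRanks : rankedRanks (mr ++ mu) ≡ map (rank ∘ proj₂) mr
    movedRanks = rankedRanks-separated (All.map proj₁ mr<) mu-unranked
    keptRanks : rankedRanks (kr ++ ku) ≡ map (rank ∘ proj₂) kr
    keptRanks = rankedRanks-separated (All.map proj₁ kr≥) ku-unranked
    split : map (rank ∘ proj₂) mr ++ map (rank ∘ proj₂) kr ↭ upTo r
    split = begin
      map (rank ∘ proj₂) mr ++ map (rank ∘ proj₂) kr ≡⟨ sym (cong₂ _++_ movedRanks keptRanks) ⟩
      rankedRanks (mr ++ mu) ++ rankedRanks (kr ++ ku) ≡⟨ sym (rankedRanks-++ (mr ++ mu) (kr ++ ku)) ⟩
      rankedRanks ((mr ++ mu) ++ kr ++ ku)           ≡⟨ cong rankedRanks (++-assoc mr mu (kr ++ ku)) ⟩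
      rankedRanks (mr ++ mu ++ kr ++ ku)             ↭⟨ rankedRanks-↭ (↭-sym p) ⟩
      rankedRanks cs                                 ↭⟨ rc ⟩
      upTo r                                         ∎
      where open PermutationReasoning
    parts : map (rank ∘ proj₂) mr ↭ upTo (r ∸ 2) × map (rank ∘ proj₂) kr ↭ lastTwo r
    parts = upTo-split r (All.map⁺ (All.map proj₂ mr<)) (All.map⁺ (All.map proj₂ kr≥)) split

  delete-valid : ∀ {e k r cs} → Valid (node (full e) k r cs) → Valid (node hollowDel k r cs)
  delete-valid (node ho , node rc ri) = node ho , node rc ri

  delete-heapInv : ∀ {e h h'} → Delete e h h' → HeapInv h → HeapInv h'
  delete-heapInv (root d) (_ , valid) = destroyPhase-heapInv d (delete-valid valid ∷ [])
  delete-heapInv {e} (nonRoot {s} {k'} {r'} {ls} {kd} {C} {rs} {k} {r} {cs}) (f , ho , ri) =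
    f , plug-heapOrdered C′ {u} refl ho (proj₁ hollowed) , plug-rankInv C′ {u} refl ri (proj₂ hollowed)
    where
    C′ : Ctx
    C′ = under s k' r' ls kd C rs
    u : Tree
    u = node (full e) k r cs
    hollowed : Valid (node hollowDel k r cs)
    hollowed = delete-valid (plug-heapOrdered⁻ C′ u ho , plug-rankInv⁻ C′ u ri)

  orderedUnder-lower : ∀ {k k₀ cs} → k ≤ₖ k₀ → All (OrderedUnder k₀) cs → All (OrderedUnder k) cs
  orderedUnder-lower k≤k₀ = All.map (λ (k₀≤ , hoₚ) → ≤ₖ-trans k≤k₀ k₀≤ , hoₚ)

  decKey-split : ∀ {e k k₀ r cs mr mu kr ku} → k <ₖ k₀ → cs ↭ mr ++ mu ++ kr ++ ku →
    All (λ p → IsRanked p × rank (proj₂ p) < r ∸ 2) mr → All IsUnranked mu →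
    All (λ p → IsRanked p × r ∸ 2 ≤ rank (proj₂ p)) kr → All IsUnranked ku →
    Valid (node (full e) k₀ r cs) →
    HeapInv (just (node (full e) k (r ∸ 2) (mr ++ mu))) × Valid (node hollowDK k₀ r (kr ++ ku))
  decKey-split {k = k} {k₀} {r} {cs} {mr} {mu} {kr} {ku} k<k₀ p mr< mu-unranked kr≥ ku-unranked
    (node ho , node rc ri) =
    (isFull , node (orderedUnder-lower (proj₁ k<k₀) (proj₁ orders)) , node (proj₁ conds) (proj₁ rankInvs)) ,
    (node (proj₂ orders) , node (proj₂ conds) (proj₂ rankInvs))
    where
    conds : rankedRanks (mr ++ mu) ↭ upTo (r ∸ 2) × RankCond hollowDK r (rankedRanks (kr ++ ku))
    conds = decKey-rankConds r rc p mr< mu-unranked kr≥ ku-unranked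
    regroup : ∀ {q} {Q : Pred (Kind × Tree) q} → All Q cs → All Q (mr ++ mu) × All Q (kr ++ ku)
    regroup {Q = Q} qs = All.++⁻ (mr ++ mu) (subst (All Q) (sym (++-assoc mr mu (kr ++ ku))) (All-resp-↭ p qs))
    orders : All (OrderedUnder k₀) (mr ++ mu) × All (OrderedUnder k₀) (kr ++ ku)
    orders = regroup ho
    rankInvs : All (RankInv ∘ proj₂) (mr ++ mu) × All (RankInv ∘ proj₂) (kr ++ ku)
    rankInvs = regroup ri

  decKey-heapInv : ∀ {e k h h'} → DecKey e k h h' → HeapInv h → HeapInv h'
  decKey-heapInv (atRoot k<k₀) (f , node ho , node rc ri) =
    f , node (orderedUnder-lower (proj₁ k<k₀) ho) , node rc ri
  decKey-heapInv {e}
    (nonRoot {s} {k'} {r'} {ls} {kd} {C} {rs} {k₀} {r} {cs} k<k₀ p mr< mu-unranked kr≥ ku-unranked m)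
    (f , ho , ri) =
    let newRoot , (hoᵤ , riᵤ) = decKey-split k<k₀ p mr< mu-unranked kr≥ ku-unranked
                                  (plug-heapOrdered⁻ C′ u ho , plug-rankInv⁻ C′ u ri)
    in  meld-heapInv m newRoot (f , plug-heapOrdered C′ {u} refl ho hoᵤ , plug-rankInv C′ {u} refl ri riᵤ)
    where
    C′ : Ctx
    C′ = under s k' r' ls kd C rs
    u : Tree
    u = node (full e) k₀ r cs

  singleton-heapInv : ∀ e k → HeapInv (just (node (full e) k 0 []))
  singleton-heapInv e k = isFull , node [] , node refl []

  items-↭ : ∀ {xs ys : List (Item × Key)} → xs ↭ ys → map proj₁ xs ↭ map proj₁ ys
  items-↭ = ↭-map⁺ proj₁

  delete-invariant : ∀ {e h h'} → Delete e h h' →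
    Unique (items h) × HeapInv h → Unique (items h') × HeapInv h'
  delete-invariant d (uniq , inv) with Unique-resp-↭ (items-↭ (proj₂ (delete-contents d))) uniq
  ... | _ ∷ uniq′ = uniq′ , delete-heapInv d inv

  reachable-invariant : ∀ {h} → Reachable h → Unique (items h) × HeapInv h
  reachable-invariant makeHeap = [] , tt
  reachable-invariant (insert {e} {k} {h} reach e∉h ins) with reachable-invariant reach
  ... | uniq , inv =
    Unique-resp-↭ (↭-sym (items-↭ (meld-contents ins))) (All.¬Any⇒All¬ (items h) e∉h ∷ uniq) ,
    meld-heapInv ins (singleton-heapInv e k) inv
  reachable-invariant (meld {h₁} {h₂} reach₁ reach₂ disjoint m)
    with reachable-invariant reach₁ | reachable-invariant reach₂
  ... | uniq₁ , inv₁ | uniq₂ , inv₂ =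
    Unique-resp-↭
      (↭-sym (trans (items-↭ (meld-contents m)) (↭-reflexive (map-++ proj₁ (contents h₁) (contents h₂)))))
      (Unique.++⁺ uniq₁ uniq₂ λ (x∈h₁ , x∈h₂) → disjoint x∈h₁ x∈h₂) ,
    meld-heapInv m inv₁ inv₂
  reachable-invariant (decKey reach d) with reachable-invariant reach | decKey-contents d
  ... | uniq , inv | _ , _ , _ , before , after =
    Unique-resp-↭ (trans (items-↭ before) (↭-sym (items-↭ after))) uniq , decKey-heapInv d inv
  reachable-invariant (delete reach d)                 = delete-invariant d (reachable-invariant reach)
  reachable-invariant (deleteMin reach (deleteRoot d)) = delete-invariant d (reachable-invariant reach)

  held-∈ : ∀ {s k e k₀} → (e , k₀) ∈ held s k → s ≡ full e × k₀ ≡ k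
  held-∈ {full _}    (here refl) = refl , refl
  held-∈ {hollowDK}  ()
  held-∈ {hollowDel} ()

  heapOrdered-minimal : ∀ t → HeapOrdered t → ∀ {e k₀} → (e , k₀) ∈ contentsT t → key t ≤ₖ k₀
  children-minimal : ∀ {k} cs → All (OrderedUnder k) cs → ∀ {e k₀} → (e , k₀) ∈ contentsF cs → k ≤ₖ k₀

  heapOrdered-minimal (node s k r cs) (node ho) x∈ with ∈-++⁻ (held s k) x∈
  ... | inj₁ x∈held with refl , refl ← held-∈ x∈held = ≤ₖ-refl
  ... | inj₂ x∈cs = children-minimal cs ho x∈cs

  children-minimal ((_ , t) ∷ cs) ((k≤t , hoₜ) ∷ ho) x∈ with ∈-++⁻ (contentsT t) x∈
  ... | inj₁ x∈t  = ≤ₖ-trans k≤t (heapOrdered-minimal t hoₜ x∈t)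
  ... | inj₂ x∈cs = children-minimal cs ho x∈cs

  findMin-nothing⇒empty : ∀ {h} → HeapInv h → findMin h ≡ nothing → contents h ≡ []
  findMin-nothing⇒empty {nothing}                      _          _  = refl
  findMin-nothing⇒empty {just (node (full e) k r cs)} (isFull , _) ()

  empty⇒findMin-nothing : ∀ {h} → HeapInv h → contents h ≡ [] → findMin h ≡ nothing
  empty⇒findMin-nothing {nothing}                      _          _  = refl
  empty⇒findMin-nothing {just (node (full e) k r cs)} (isFull , _) ()

  findMin-minimal : ∀ {h} → HeapInv h → ∀ e → findMin h ≡ just e →
    Σ Key (λ k → (e , k) ∈ contents h × (∀ {e' k'} → (e' , k') ∈ contents h → k ≤ₖ k'))
  findMin-minimal {just (node (full e) k r cs)} (isFull , ho , _) .e refl =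
    k , here refl , heapOrdered-minimal (node (full e) k r cs) ho

  link-exists : ∀ kd {a b} → IsFull (status a) → IsFull (status b) → Σ Tree (Link kd a b)
  link-exists kd {a} {b} fa fb with total (key a) (key b)
  ... | inj₁ a≤b = _ , winˡ fa fb a≤b
  ... | inj₂ b≤a = _ , winʳ fa fb b≤a

  meld-exists : ∀ {h₁ h₂} → HeapInv h₁ → HeapInv h₂ → Σ Heap (Meld h₁ h₂)
  meld-exists {nothing} {h₂}      _        _        = h₂ , emptyˡ
  meld-exists {just t}  {nothing} _        _        = just t , emptyʳ
  meld-exists {just a}  {just b}  (fa , _) (fb , _) with w , l ← link-exists unranked fa fb = just w , link l

  data Location (e : Item) (k₀ : Key) : Tree → Set (i ⊔ c) where
    at : ∀ C r cs → Location e k₀ (plug C (node (full e) k₀ r cs))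

  data LocationF (e : Item) (k₀ : Key) : List (Kind × Tree) → Set (i ⊔ c) where
    at : ∀ ls kd C r cs rs → LocationF e k₀ (ls ++ (kd , plug C (node (full e) k₀ r cs)) ∷ rs)

  locate : ∀ t {e k₀} → (e , k₀) ∈ contentsT t → Location e k₀ t
  locateF : ∀ cs {e k₀} → (e , k₀) ∈ contentsF cs → LocationF e k₀ cs

  locate (node s k r cs) x∈ with ∈-++⁻ (held s k) x∈
  ... | inj₁ x∈held with refl , refl ← held-∈ x∈held = at hole r cs
  ... | inj₂ x∈cs with at ls kd C r′ cs′ rs ← locateF cs x∈cs = at (under s k r ls kd C rs) r′ cs′

  locateF ((kd , t) ∷ cs) x∈ with ∈-++⁻ (contentsT t) x∈
  ... | inj₁ x∈t with at C r cs′ ← locate t x∈t = at [] kd C r cs′ cs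
  ... | inj₂ x∈cs with at ls kd′ C r cs′ rs ← locateF cs x∈cs = at ((kd , t) ∷ ls) kd′ C r cs′ rs

  record RankPartition (m : ℕ) (cs : List (Kind × Tree)) : Set (i ⊔ c) where
    constructor partition
    field
      low high unrankedCs : List (Kind × Tree)
      ↭-parts    : cs ↭ low ++ high ++ unrankedCs
      low-<      : All (λ p → IsRanked p × rank (proj₂ p) < m) low
      high-≥     : All (λ p → IsRanked p × m ≤ rank (proj₂ p)) high
      unranked-∀ : All IsUnranked unrankedCs

  rankPartition : ∀ m cs → RankPartition m cs
  rankPartition m [] = partition [] [] [] refl [] [] []
  rankPartition m ((ranked , t) ∷ cs) with rankPartition m cs | rank t <? m
  ... | partition lo hi un p lo< hi≥ un∀ | yes t<m =
    partition ((ranked , t) ∷ lo) hi un (prep _ p) ((refl , t<m) ∷ lo<) hi≥ un∀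
  ... | partition lo hi un p lo< hi≥ un∀ | no t≮m =
    partition lo ((ranked , t) ∷ hi) un (trans (prep _ p) (↭-sym (shift (ranked , t) lo (hi ++ un))))
      lo< ((refl , ≮⇒≥ t≮m) ∷ hi≥) un∀
  rankPartition m ((unranked , t) ∷ cs) with rankPartition m cs
  ... | partition lo hi un p lo< hi≥ un∀ =
    partition lo hi ((unranked , t) ∷ un) moveToEnd lo< hi≥ (refl ∷ un∀)
    where
    moveToEnd : (unranked , t) ∷ cs ↭ lo ++ hi ++ (unranked , t) ∷ un
    moveToEnd = begin
      (unranked , t) ∷ cs                ↭⟨ prep _ p ⟩
      (unranked , t) ∷ lo ++ hi ++ un    ≡⟨ cong ((unranked , t) ∷_) (sym (++-assoc lo hi un)) ⟩
      (unranked , t) ∷ (lo ++ hi) ++ un  ↭⟨ ↭-sym (shift (unranked , t) (lo ++ hi) un) ⟩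
      (lo ++ hi) ++ (unranked , t) ∷ un  ≡⟨ ++-assoc lo hi ((unranked , t) ∷ un) ⟩
      lo ++ hi ++ (unranked , t) ∷ un    ∎
      where open PermutationReasoning

  decKey-exists : ∀ {h e k₀ k} → HeapInv h → (e , k₀) ∈ contents h → k <ₖ k₀ → Σ Heap (DecKey e k h)
  decKey-exists {just t} inv x∈ k<k₀ with locate t x∈
  ... | at hole r cs = _ , atRoot k<k₀
  decKey-exists {just t} {e} {k = k} (f , _) x∈ k<k₀ | at (under s k' r' ls kd C rs) r cs
    with partition lo hi un p lo< hi≥ un∀ ← rankPartition (r ∸ 2) cs
    with w , l ← link-exists unranked {node (full e) k (r ∸ 2) (lo ++ [])} isFull f
    -- v takes no unranked child of u (the empty subset)
    = just w , nonRoot k<k₀ p lo< [] hi≥ un∀ (link l)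

  unrankedPhase-↭ : ∀ {ts ts′ h} → ts′ ↭ ts → UnrankedPhase ts h → UnrankedPhase ts′ h
  unrankedPhase-↭ q none with refl ← ↭-empty-inv q     = none
  unrankedPhase-↭ q one  with refl ← ↭-singleton-inv q = one
  unrankedPhase-↭ q (step p l d) = step (trans q p) l d

  rankedPhase-↭ : ∀ {ts ts′ h} → ts′ ↭ ts → RankedPhase ts h → RankedPhase ts′ h
  rankedPhase-↭ q (step p l d)  = step (trans q p) l d
  rankedPhase-↭ q (finish u d) = finish (Unique-resp-↭ (↭-map⁺ rank (↭-sym q)) u) (unrankedPhase-↭ q d)

  destroyPhase-↭ : ∀ {ts ts′ h} → ts′ ↭ ts → DestroyPhase ts h → DestroyPhase ts′ h
  destroyPhase-↭ q (destroy p hol d) = destroy (trans q p) hol d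
  destroyPhase-↭ q (finish fs d)     = finish (All-resp-↭ (↭-sym q) fs) (rankedPhase-↭ q d)

  Full : Tree → Set i
  Full = IsFull ∘ status

  unrankedPhase-exists : ∀ ts → All Full ts → Σ Heap (UnrankedPhase ts)
  unrankedPhase-exists []         []           = nothing , none
  unrankedPhase-exists (a ∷ rest) (fa ∷ frest) = linkInto a rest fa frest
    where
    linkInto : ∀ a rest → Full a → All Full rest → Σ Heap (UnrankedPhase (a ∷ rest))
    linkInto a []         _  []           = just a , one
    linkInto a (b ∷ rest) fa (fb ∷ frest)
      with w , l ← link-exists unranked fa fb
      with h , d ← linkInto w rest (link-full l) frest
      = h , step refl l d

  RankCollision : List Tree → Set (i ⊔ c)
  RankCollision ts =
    Σ Tree λ a → Σ Tree λ b → Σ (List Tree) λ rest → ts ↭ a ∷ b ∷ rest × rank a ≡ rank b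

  rankCollision? : ∀ ts → Unique (map rank ts) ⊎ RankCollision ts
  rankCollision? [] = inj₁ []
  rankCollision? (t ∷ us) with any? (λ u → rank t ≟ rank u) us
  ... | yes hit with u , u∈us , eq ← find hit with ys , zs , refl ← ∈-∃++ u∈us =
    inj₂ (t , u , ys ++ zs , prep t (shift u ys zs) , eq)
  ... | no miss with rankCollision? us
  ...   | inj₁ uniq = inj₁ (All.map⁺ (All.¬Any⇒All¬ us miss) ∷ uniq)
  ...   | inj₂ (a , b , rest , p , eq) =
    inj₂ (a , b , t ∷ rest , trans (prep t p) (↭-sym (shift t (a ∷ b ∷ []) rest)) , eq)

  rankedPhase-exists : ∀ ts → All Full ts → Σ Heap (RankedPhase ts)
  rankedPhase-exists ts = withFuel (length ts) ts ≤-refl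
    where
    withFuel : ∀ n ts → length ts ≤ n → All Full ts → Σ Heap (RankedPhase ts)
    linkCollision : ∀ n {ts} → length ts ≤ n → All Full ts → RankCollision ts → Σ Heap (RankedPhase ts)

    withFuel n ts len≤ fulls with rankCollision? ts
    ... | inj₁ uniq with h , d ← unrankedPhase-exists ts fulls = h , finish uniq d
    ... | inj₂ collision = linkCollision n len≤ fulls collision

    linkCollision zero    len≤ _     (_ , _ , _ , p , _) with () ← subst (_≤ 0) (↭-length p) len≤
    linkCollision (suc n) len≤ fulls (a , b , rest , p , eq)
      with fa ∷ fb ∷ frest ← All-resp-↭ p fulls
      with w , l ← link-exists ranked fa fb
      with h , d ← withFuel n (w ∷ rest) (s≤s⁻¹ (subst (_≤ suc n) (↭-length p) len≤))
                            (link-full l ∷ frest)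
      = h , step p (eq , l) d

  fullFrontier : Tree → List Tree
  fullFrontierF : List (Kind × Tree) → List Tree

  fullFrontier (node (full e) k r cs) = node (full e) k r cs ∷ []
  fullFrontier (node hollowDK k r cs)  = fullFrontierF cs
  fullFrontier (node hollowDel k r cs) = fullFrontierF cs

  fullFrontierF []             = []
  fullFrontierF ((_ , t) ∷ cs) = fullFrontier t ++ fullFrontierF cs

  fullFrontier-full : ∀ t → All Full (fullFrontier t)
  fullFrontierF-full : ∀ cs → All Full (fullFrontierF cs)

  fullFrontier-full (node (full e) k r cs) = isFull ∷ []
  fullFrontier-full (node hollowDK k r cs)  = fullFrontierF-full cs
  fullFrontier-full (node hollowDel k r cs) = fullFrontierF-full cs

  fullFrontierF-full []             = []
  fullFrontierF-full ((_ , t) ∷ cs) = All.++⁺ (fullFrontier-full t) (fullFrontierF-full cs)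

  destroyTo-fullFrontier : ∀ t rest {h} → DestroyPhase (fullFrontier t ++ rest) h → DestroyPhase (t ∷ rest) h
  destroyTo-fullFrontierF : ∀ cs rest {h} →
    DestroyPhase (fullFrontierF cs ++ rest) h → DestroyPhase (map proj₂ cs ++ rest) h

  destroyTo-fullFrontier (node (full e) k r cs) rest d = d
  destroyTo-fullFrontier (node hollowDK k r cs)  rest d = destroy refl isHollowDK (destroyTo-fullFrontierF cs rest d)
  destroyTo-fullFrontier (node hollowDel k r cs) rest d = destroy refl isHollowDel (destroyTo-fullFrontierF cs rest d)

  destroyTo-fullFrontierF []              rest d = d
  destroyTo-fullFrontierF ((kd , t) ∷ cs) rest d =
    destroyTo-fullFrontier t (map proj₂ cs ++ rest)
      (destroyPhase-↭ (shifts (fullFrontier t) (map proj₂ cs))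
        (destroyTo-fullFrontierF cs (fullFrontier t ++ rest)
          (destroyPhase-↭ reorder d)))
    where
    reorder : fullFrontierF cs ++ fullFrontier t ++ rest ↭ fullFrontierF ((kd , t) ∷ cs) ++ rest
    reorder = trans (shifts (fullFrontierF cs) (fullFrontier t))
                    (↭-reflexive (sym (++-assoc (fullFrontier t) (fullFrontierF cs) rest)))

  destroyPhase-exists : ∀ t → Σ Heap (DestroyPhase (t ∷ []))
  destroyPhase-exists t = map₂ (destroyTo-fullFrontier t [] ∘ finish fulls) (rankedPhase-exists _ fulls)
    where
    fulls : All Full (fullFrontier t ++ [])
    fulls = All.++⁺ (fullFrontier-full t) []

  delete-exists : ∀ {h e} → e ∈ items h → Σ Heap (Delete e h)
  delete-exists {just t} e∈ with (_ , k) , x∈ , refl ← ∈-map⁻ proj₁ e∈ with locate t x∈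
  ... | at hole r cs with h′ , d ← destroyPhase-exists (node hollowDel k r cs) = h′ , root d
  ... | at (under _ _ _ _ _ _ _) _ _ = _ , nonRoot

  deleteMin-exists : ∀ {h} → HeapInv h → h ≢ nothing → Σ Heap (DeleteMin h)
  deleteMin-exists {nothing} _ h≢nothing = ⊥-elim (h≢nothing refl)
  deleteMin-exists {just (node (full e) k r cs)} (isFull , _) _
    with h′ , d ← destroyPhase-exists (node hollowDel k r cs) = h′ , deleteRoot (root d)

  deleteMin-contents : ∀ {h h'} → DeleteMin h h' →
    Σ Item (λ e → findMin h ≡ just e × Σ Key (λ k → contents h ↭ (e , k) ∷ contents h'))
  deleteMin-contents (deleteRoot {e} d) = e , refl , delete-contents d

theorem3p1 : ∀ {i c ℓ₁ ℓ₂} (Item : Set i) (O : TotalOrder c ℓ₁ ℓ₂) →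
    let open HollowHeap Item O in
    contents nothing ≡ []
    × (∀ h → Reachable h →
      (Unique (items h) × HeapInv h)
      × (findMin h ≡ nothing → contents h ≡ [])
      × (contents h ≡ [] → findMin h ≡ nothing)
      × (∀ e → findMin h ≡ just e →
           Σ Key (λ k → (e , k) ∈ contents h
             × (∀ {e' k'} → (e' , k') ∈ contents h → k ≤ₖ k')))
      × (∀ e k → e ∉ items h → Σ Heap (Insert e k h))
      × (∀ e k h' → e ∉ items h → Insert e k h h' → contents h' ↭ ((e , k) ∷ contents h))
      × (∀ h₂ → Reachable h₂ → Disjoint (items h) (items h₂) →
           Σ Heap (Meld h h₂)
           × (∀ h' → Meld h h₂ h' → contents h' ↭ (contents h ++ contents h₂)))
      × (∀ e k₀ k → (e , k₀) ∈ contents h → k <ₖ k₀ → Σ Heap (DecKey e k h))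
      × (∀ e k h' → DecKey e k h h' →
           Σ Key (λ k₀ → k <ₖ k₀ × Σ (List (Item × Key)) (λ rest →
             contents h ↭ ((e , k₀) ∷ rest) × contents h' ↭ ((e , k) ∷ rest))))
      × (∀ e → e ∈ items h → Σ Heap (Delete e h))
      × (∀ e h' → Delete e h h' → Σ Key (λ k → contents h ↭ ((e , k) ∷ contents h')))
      × (h ≢ nothing → Σ Heap (DeleteMin h))
      × (∀ h' → DeleteMin h h' →
           Σ Item (λ e → findMin h ≡ just e
             × Σ Key (λ k → contents h ↭ ((e , k) ∷ contents h')))))
theorem3p1 Item O = refl , λ h reach →
  let invariant = reachable-invariant reach
      inv       = proj₂ invariant
  in  invariant
    , findMin-nothing⇒empty inv
    , empty⇒findMin-nothing inv
    , findMin-minimal inv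
    , (λ e k _ → meld-exists (singleton-heapInv e k) inv)
    , (λ _ _ _ _ → meld-contents)
    , (λ h₂ reach₂ _ → meld-exists inv (proj₂ (reachable-invariant reach₂)) , λ _ → meld-contents)
    , (λ _ _ _ x∈ k<k₀ → decKey-exists inv x∈ k<k₀)
    , (λ _ _ _ → decKey-contents)
    , (λ _ → delete-exists)
    , (λ _ _ → delete-contents)
    , deleteMin-exists inv
    , (λ _ → deleteMin-contents)
  where open HollowHeapProperties Item O
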